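{- Let $n\ge 3$ and $i,j,k,r,s\ge0$. The number of tip-augmented plane trees with $n$ edges, $i$ singleton leaves, $j$ elder twin leaves, $k$ elder non-twin leaves, $r$ younger leaves and $s$ second leaves equals the number of tip-augmented plane trees with $n$ edges, $k$ singleton leaves, $j$ elder twin leaves, $i$ elder non-twin leaves, $r$ younger leaves and $s$ second leaves.
   Context: A plane tree is an unlabeled rooted tree in which the children of every vertex are linearly ordered from left to right. A leaf is a vertex with no children, an interior vertex one with at least one child. A tip-augmented plane tree is a plane tree in which the leftmost child of every interior vertex is a leaf. In such a tree: a leaf without siblings is a singleton leaf; a leaf with siblings that is the leftmost child of its parent is an elder twin leaf if the second child of its parent is also a leaf, and an elder non-twin leaf otherwise; a leaf with siblings that is the second child of its parent is a second leaf; a leaf with siblings that is neither the first nor the second child of its parent is a younger leaf. -}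

module Defs where

open import Data.Nat using (ℕ; zero; suc; _+_)
open import Data.Bool using (Bool; true; false; _∧_)
open import Data.List using (List; []; _∷_; _++_; length; filter)
open import Relation.Binary.PropositionalEquality using (_≡_)
open import Relation.Nullary using (Dec; yes; no)
open import Data.Product using (Σ; _×_)

data PTree : Set where
  node : List PTree → PTree

mutual
  edges : PTree → ℕ
  edges (node cs) = edgesL cs

  edgesL : List PTree → ℕ
  edgesL []       = 0
  edgesL (c ∷ cs) = suc (edges c + edgesL cs)

isLeaf : PTree → Bool
isLeaf (node []) = true
isLeaf (node (_ ∷ _)) = false

mutual
  tipAugmented : PTree → Bool
  tipAugmented (node [])       = true
  tipAugmented (node (c ∷ cs)) = isLeaf c ∧ tipAugmentedL (c ∷ cs)

  tipAugmentedL : List PTree → Bool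
  tipAugmentedL []       = true
  tipAugmentedL (c ∷ cs) = tipAugmented c ∧ tipAugmentedL cs

data LeafKind : Set where
  singleton elderTwin elderNonTwin second younger : LeafKind

leafIf : Bool → LeafKind → List LeafKind
leafIf true  k = k ∷ []
leafIf false k = []

youngerKinds : List PTree → List LeafKind
youngerKinds []       = []
youngerKinds (c ∷ cs) = leafIf (isLeaf c) younger ++ youngerKinds cs

childKinds : List PTree → List LeafKind
childKinds []             = []
childKinds (c ∷ [])       = leafIf (isLeaf c) singleton
childKinds (c ∷ d ∷ rest) =
  leafIf (isLeaf c) (elderKind (isLeaf d)) ++ leafIf (isLeaf d) second ++ youngerKinds rest
  where
  elderKind : Bool → LeafKind
  elderKind true  = elderTwin
  elderKind false = elderNonTwin

-- the kinds of all (non-root) leaves of a tree, one entry per leaf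
mutual
  leafKinds : PTree → List LeafKind
  leafKinds (node cs) = childKinds cs ++ leafKindsL cs

  leafKindsL : List PTree → List LeafKind
  leafKindsL []       = []
  leafKindsL (c ∷ cs) = leafKinds c ++ leafKindsL cs

_≟K_ : (a b : LeafKind) → Dec (a ≡ b)
singleton ≟K singleton = yes _≡_.refl
elderTwin ≟K elderTwin = yes _≡_.refl
elderNonTwin ≟K elderNonTwin = yes _≡_.refl
second ≟K second = yes _≡_.refl
younger ≟K younger = yes _≡_.refl
singleton ≟K elderTwin = no λ ()
singleton ≟K elderNonTwin = no λ ()
singleton ≟K second = no λ ()
singleton ≟K younger = no λ ()
elderTwin ≟K singleton = no λ ()
elderTwin ≟K elderNonTwin = no λ ()
elderTwin ≟K second = no λ ()
elderTwin ≟K younger = no λ ()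
elderNonTwin ≟K singleton = no λ ()
elderNonTwin ≟K elderTwin = no λ ()
elderNonTwin ≟K second = no λ ()
elderNonTwin ≟K younger = no λ ()
second ≟K singleton = no λ ()
second ≟K elderTwin = no λ ()
second ≟K elderNonTwin = no λ ()
second ≟K younger = no λ ()
younger ≟K singleton = no λ ()
younger ≟K elderTwin = no λ ()
younger ≟K elderNonTwin = no λ ()
younger ≟K second = no λ ()

numLeaves : LeafKind → PTree → ℕ
numLeaves k t = length (filter (_≟K k) (leafKinds t))

TAPT : (n i j k r s : ℕ) → Set
TAPT n i j k r s = Σ PTree λ t →
  (tipAugmented t ≡ true) × (edges t ≡ n) ×
  (numLeaves singleton t ≡ i) × (numLeaves elderTwin t ≡ j) ×
  (numLeaves elderNonTwin t ≡ k) × (numLeaves younger t ≡ r) ×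
  (numLeaves second t ≡ s)

-- Every interior vertex of a tip-augmented tree has children leaf, g leaves, I₁, h₁
-- leaves, …, Iₘ, hₘ leaves with interior vertices Iₚ. Encoding this list as the
-- right spine bin h₁ ⟦I₁⟧ (… (bin hₘ ⟦Iₘ⟧ (tip g))) identifies the trees with at
-- least one edge with binary trees whose tips and nodes carry natural numbers. Each
-- tip g records the first g + 1 leaves of one vertex: for g ≥ 1 they are an elder
-- twin, a second leaf and g − 1 younger leaves, while for g = 0 the lone leading
-- leaf is a singleton if the tip is a left child (the vertex has no interior child)
-- and an elder non-twin leaf if it is a right child. Every hₚ contributes hₚ younger
-- leaves. Mirroring the binary tree therefore preserves the number of edges and all
-- leaf kinds except that it exchanges singletons with elder non-twins. The root of
-- the binary tree is read as a left child and mirroring swaps the sides of all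
-- readings; for the root this matters only for tip 0, the code of the one-edge tree.
module Submission where

open import Defs
open import Data.Nat using (ℕ; _≥_)
open import Function.Bundles using (_↔_)

open import Axiom.UniquenessOfIdentityProofs.WithK using (uip)
open import Data.Bool using (true; _∧_)
open import Data.List using (List; []; _∷_; _++_; length; filter; replicate; map)
open import Data.List.Properties using (++-identityʳ; filter-++; length-++; map-replicate)
open import Data.Nat using (zero; suc; _+_; _<_; _≤_)
open import Data.Nat.Properties using (+-suc; +-comm; +-identityʳ; <⇒≤; ≤-pred)
open import Data.Nat.Tactic.RingSolver using (solve-∀)
open import Data.Product using (_×_; _,_; proj₁)
open import Function.Base using (_∘_)
open import Function.Bundles using (mk↔ₛ′)
open import Function.Definitions using (Injective)
open import Relation.Binary.PropositionalEquality
open import Relation.Nullary using (yes; no; contradiction)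

open ≡-Reasoning

∧≡true⇒× : ∀ {a b} → a ∧ b ≡ true → a ≡ true × b ≡ true
∧≡true⇒× {true} b≡true = refl , b≡true

leaf : PTree
leaf = node []

leaves : ℕ → List PTree
leaves m = replicate m leaf

leaves-snoc : ∀ m (xs : List PTree) → leaves m ++ leaf ∷ xs ≡ leaf ∷ leaves m ++ xs
leaves-snoc zero    xs = refl
leaves-snoc (suc m) xs = cong (leaf ∷_) (leaves-snoc m xs)

edgesL-leaves-++ : ∀ m xs → edgesL (leaves m ++ xs) ≡ m + edgesL xs
edgesL-leaves-++ zero    xs = refl
edgesL-leaves-++ (suc m) xs = cong suc (edgesL-leaves-++ m xs)

tipAugmentedL-leaves-++ : ∀ m xs → tipAugmentedL (leaves m ++ xs) ≡ tipAugmentedL xs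
tipAugmentedL-leaves-++ zero    xs = refl
tipAugmentedL-leaves-++ (suc m) xs = tipAugmentedL-leaves-++ m xs

leafKindsL-leaves-++ : ∀ m xs → leafKindsL (leaves m ++ xs) ≡ leafKindsL xs
leafKindsL-leaves-++ zero    xs = refl
leafKindsL-leaves-++ (suc m) xs = leafKindsL-leaves-++ m xs

youngerKinds-leaves-++ : ∀ m xs →
  youngerKinds (leaves m ++ xs) ≡ replicate m younger ++ youngerKinds xs
youngerKinds-leaves-++ zero    xs = refl
youngerKinds-leaves-++ (suc m) xs = cong (younger ∷_) (youngerKinds-leaves-++ m xs)

data DTree : Set where
  tip : ℕ → DTree
  bin : ℕ → DTree → DTree → DTree

lead : DTree → ℕ
lead (tip g)     = g
lead (bin _ _ r) = lead r

mutual
  decode : DTree → PTree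
  decode d = node (leaf ∷ children d)

  children : DTree → List PTree
  children d = leaves (lead d) ++ afterLead d

  afterLead : DTree → List PTree
  afterLead (tip _)     = []
  afterLead (bin h l r) = decode l ∷ leaves h ++ afterLead r

-- encodeLead g xs: g leading leaves read so far;
-- encodeTrail g e h xs: the last interior child read is encoded by e and has been
-- followed by h leaves.
mutual
  encodeChildren : List PTree → DTree
  encodeChildren xs = encodeLead 0 xs

  encodeLead : ℕ → List PTree → DTree
  encodeLead g []                    = tip g
  encodeLead g (node []       ∷ xs) = encodeLead (suc g) xs
  encodeLead g (node (_ ∷ cs) ∷ xs) = encodeTrail g (encodeChildren cs) 0 xs

  encodeTrail : ℕ → DTree → ℕ → List PTree → DTree
  encodeTrail g e h []                    = bin h e (tip g)
  encodeTrail g e h (node []       ∷ xs) = encodeTrail g e (suc h) xs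
  encodeTrail g e h (node (_ ∷ cs) ∷ xs) = bin h e (encodeTrail g (encodeChildren cs) 0 xs)

mirror : DTree → DTree
mirror (tip g)     = tip g
mirror (bin h l r) = bin h (mirror r) (mirror l)

mirror-involutive : ∀ d → mirror (mirror d) ≡ d
mirror-involutive (tip g)     = refl
mirror-involutive (bin h l r) = cong₂ (bin h) (mirror-involutive l) (mirror-involutive r)

encodeLead-leaves-++ : ∀ g m xs → encodeLead g (leaves m ++ xs) ≡ encodeLead (g + m) xs
encodeLead-leaves-++ g zero    xs = cong (λ g′ → encodeLead g′ xs) (sym (+-identityʳ g))
encodeLead-leaves-++ g (suc m) xs =
  trans (encodeLead-leaves-++ (suc g) m xs) (cong (λ g′ → encodeLead g′ xs) (sym (+-suc g m)))

encodeTrail-leaves-++ : ∀ g e h m xs →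
  encodeTrail g e h (leaves m ++ xs) ≡ encodeTrail g e (h + m) xs
encodeTrail-leaves-++ g e h zero    xs = cong (λ h′ → encodeTrail g e h′ xs) (sym (+-identityʳ h))
encodeTrail-leaves-++ g e h (suc m) xs =
  trans (encodeTrail-leaves-++ g e (suc h) m xs) (cong (λ h′ → encodeTrail g e h′ xs) (sym (+-suc h m)))

mutual
  encodeChildren-children : ∀ d → encodeChildren (children d) ≡ d
  encodeChildren-children d = begin
    encodeLead 0 (leaves (lead d) ++ afterLead d) ≡⟨ encodeLead-leaves-++ 0 (lead d) (afterLead d) ⟩
    encodeLead (lead d) (afterLead d)             ≡⟨ encodeLead-afterLead d ⟩
    d                                             ∎

  encodeLead-afterLead : ∀ d → encodeLead (lead d) (afterLead d) ≡ d
  encodeLead-afterLead (tip g)     = refl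
  encodeLead-afterLead (bin h l r) = encodeTrail-decode l h r

  encodeTrail-afterLead : ∀ e h d → encodeTrail (lead d) e h (afterLead d) ≡ bin h e d
  encodeTrail-afterLead e h (tip g)      = refl
  encodeTrail-afterLead e h (bin h′ l r) = cong (bin h e) (encodeTrail-decode l h′ r)

  encodeTrail-decode : ∀ l h r →
    encodeTrail (lead r) (encodeChildren (children l)) 0 (leaves h ++ afterLead r) ≡ bin h l r
  encodeTrail-decode l h r = begin
    encodeTrail (lead r) (encodeChildren (children l)) 0 (leaves h ++ afterLead r)
      ≡⟨ cong (λ e → encodeTrail (lead r) e 0 (leaves h ++ afterLead r)) (encodeChildren-children l) ⟩
    encodeTrail (lead r) l 0 (leaves h ++ afterLead r)
      ≡⟨ encodeTrail-leaves-++ (lead r) l 0 h (afterLead r) ⟩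
    encodeTrail (lead r) l h (afterLead r)
      ≡⟨ encodeTrail-afterLead l h r ⟩
    bin h l r
      ∎

lead-encodeTrail : ∀ g e h xs → lead (encodeTrail g e h xs) ≡ g
lead-encodeTrail g e h []                    = refl
lead-encodeTrail g e h (node []       ∷ xs) = lead-encodeTrail g e (suc h) xs
lead-encodeTrail g e h (node (_ ∷ cs) ∷ xs) = lead-encodeTrail g (encodeChildren cs) 0 xs

mutual
  decode-encodeChildren : ∀ c cs → tipAugmented (node (c ∷ cs)) ≡ true →
    decode (encodeChildren cs) ≡ node (c ∷ cs)
  decode-encodeChildren (node []) cs ta = cong (λ xs → node (leaf ∷ xs)) (children-encodeLead 0 cs ta)

  children-encodeLead : ∀ g xs → tipAugmentedL xs ≡ true →
    children (encodeLead g xs) ≡ leaves g ++ xs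
  children-encodeLead g []                    ta = refl
  children-encodeLead g (node []       ∷ xs) ta =
    trans (children-encodeLead (suc g) xs ta) (sym (leaves-snoc g xs))
  children-encodeLead g (node (c ∷ cs) ∷ xs) ta with ∧≡true⇒× ta
  ... | taI , taxs = cong₂ _++_
    (cong leaves (lead-encodeTrail g (encodeChildren cs) 0 xs))
    (trans (afterLead-encodeTrail g (encodeChildren cs) 0 xs taxs)
           (cong (_∷ xs) (decode-encodeChildren c cs taI)))

  afterLead-encodeTrail : ∀ g e h xs → tipAugmentedL xs ≡ true →
    afterLead (encodeTrail g e h xs) ≡ decode e ∷ leaves h ++ xs
  afterLead-encodeTrail g e h []                    ta = refl
  afterLead-encodeTrail g e h (node []       ∷ xs) ta =
    trans (afterLead-encodeTrail g e (suc h) xs ta) (cong (decode e ∷_) (sym (leaves-snoc h xs)))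
  afterLead-encodeTrail g e h (node (c ∷ cs) ∷ xs) ta with ∧≡true⇒× ta
  ... | taI , taxs = cong (λ ys → decode e ∷ leaves h ++ ys)
    (trans (afterLead-encodeTrail g (encodeChildren cs) 0 xs taxs)
           (cong (_∷ xs) (decode-encodeChildren c cs taI)))

mutual
  tipAugmentedL-children : ∀ d → tipAugmentedL (children d) ≡ true
  tipAugmentedL-children d =
    trans (tipAugmentedL-leaves-++ (lead d) (afterLead d)) (tipAugmentedL-afterLead d)

  tipAugmentedL-afterLead : ∀ d → tipAugmentedL (afterLead d) ≡ true
  tipAugmentedL-afterLead (tip g) = refl
  tipAugmentedL-afterLead (bin h l r) rewrite tipAugmentedL-children l =
    trans (tipAugmentedL-leaves-++ h (afterLead r)) (tipAugmentedL-afterLead r)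

size : DTree → ℕ
size (tip g)     = g
size (bin h l r) = suc (suc h) + (size l + size r)

mutual
  edgesL-children : ∀ d → edgesL (children d) ≡ size d
  edgesL-children d =
    trans (edgesL-leaves-++ (lead d) (afterLead d)) (lead+edgesL-afterLead d)

  lead+edgesL-afterLead : ∀ d → lead d + edgesL (afterLead d) ≡ size d
  lead+edgesL-afterLead (tip g)     = +-identityʳ g
  lead+edgesL-afterLead (bin h l r) = begin
    lead r + suc (suc (edgesL (children l)) + edgesL (leaves h ++ afterLead r))
      ≡⟨ cong₂ (λ a b → lead r + suc (suc a + b)) (edgesL-children l) (edgesL-leaves-++ h (afterLead r)) ⟩
    lead r + suc (suc (size l) + (h + edgesL (afterLead r)))
      ≡⟨ rearrange (lead r) (size l) h (edgesL (afterLead r)) ⟩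
    suc (suc h) + (size l + (lead r + edgesL (afterLead r)))
      ≡⟨ cong (λ x → suc (suc h) + (size l + x)) (lead+edgesL-afterLead r) ⟩
    suc (suc h) + (size l + size r)
      ∎
    where
    rearrange : ∀ g s h e → g + suc (suc s + (h + e)) ≡ suc (suc h) + (s + (g + e))
    rearrange = solve-∀

edges-decode : ∀ d → edges (decode d) ≡ suc (size d)
edges-decode d = cong suc (edgesL-children d)

size-mirror : ∀ d → size (mirror d) ≡ size d
size-mirror (tip g)     = refl
size-mirror (bin h l r) rewrite size-mirror l | size-mirror r = cong (suc (suc h) +_) (+-comm (size r) (size l))

count : LeafKind → List LeafKind → ℕ
count k xs = length (filter (_≟K k) xs)

count-++ : ∀ k xs ys → count k (xs ++ ys) ≡ count k xs + count k ys
count-++ k xs ys = trans (cong length (filter-++ (_≟K k) xs ys)) (length-++ (filter (_≟K k) xs))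

count-map : ∀ {f} → Injective _≡_ _≡_ f → ∀ k xs → count (f k) (map f xs) ≡ count k xs
count-map         inj k []       = refl
count-map {f = f} inj k (x ∷ xs) with x ≟K k | f x ≟K f k
... | yes _   | yes _    = cong suc (count-map inj k xs)
... | no _    | no _     = count-map inj k xs
... | yes x≡k | no fx≢fk = contradiction (cong f x≡k) fx≢fk
... | no x≢k  | yes fx≡fk = contradiction (inj fx≡fk) x≢k

swapKind : LeafKind → LeafKind
swapKind singleton    = elderNonTwin
swapKind elderNonTwin = singleton
swapKind elderTwin    = elderTwin
swapKind second       = second
swapKind younger      = younger

swapKind-involutive : ∀ k → swapKind (swapKind k) ≡ k
swapKind-involutive singleton    = refl
swapKind-involutive elderNonTwin = refl
swapKind-involutive elderTwin    = refl
swapKind-involutive second       = refl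
swapKind-involutive younger      = refl

swapKind-injective : Injective _≡_ _≡_ swapKind
swapKind-injective {k} {k′} eq = begin
  k                      ≡⟨ sym (swapKind-involutive k) ⟩
  swapKind (swapKind k)  ≡⟨ cong swapKind eq ⟩
  swapKind (swapKind k′) ≡⟨ swapKind-involutive k′ ⟩
  k′                     ∎

count-swapKind : ∀ k xs → count (swapKind k) (map swapKind xs) ≡ count k xs
count-swapKind = count-map swapKind-injective

count-younger-swapKind : ∀ k h → count (swapKind k) (replicate h younger) ≡ count k (replicate h younger)
count-younger-swapKind k h =
  trans (cong (count (swapKind k)) (sym (map-replicate swapKind h younger))) (count-swapKind k (replicate h younger))

data Side : Set where
  left right : Side

opposite : Side → Side
opposite left  = right
opposite right = left

tipKinds : Side → ℕ → List LeafKind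
tipKinds left  zero    = singleton ∷ []
tipKinds right zero    = elderNonTwin ∷ []
tipKinds _     (suc g) = elderTwin ∷ second ∷ replicate g younger

tipKinds-opposite : ∀ s g → tipKinds (opposite s) g ≡ map swapKind (tipKinds s g)
tipKinds-opposite left  zero    = refl
tipKinds-opposite right zero    = refl
tipKinds-opposite left  (suc g) = cong (λ ys → elderTwin ∷ second ∷ ys) (sym (map-replicate swapKind g younger))
tipKinds-opposite right (suc g) = cong (λ ys → elderTwin ∷ second ∷ ys) (sym (map-replicate swapKind g younger))

kindCount : LeafKind → Side → DTree → ℕ
kindCount k s (tip g)     = count k (tipKinds s g)
kindCount k _ (bin h l r) = count k (replicate h younger) + (kindCount k left l + kindCount k right r)

kindCount-mirror : ∀ k s d → kindCount k s (mirror d) ≡ kindCount (swapKind k) (opposite s) d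
kindCount-mirror k s (tip g) = begin
  count k (tipKinds s g)                                  ≡⟨ sym (count-swapKind k (tipKinds s g)) ⟩
  count (swapKind k) (map swapKind (tipKinds s g))        ≡⟨ cong (count (swapKind k)) (sym (tipKinds-opposite s g)) ⟩
  count (swapKind k) (tipKinds (opposite s) g)            ∎
kindCount-mirror k s (bin h l r) = begin
  count k (replicate h younger) + (kindCount k left (mirror r) + kindCount k right (mirror l))
    ≡⟨ cong₂ _+_ (sym (count-younger-swapKind k h))
                 (cong₂ _+_ (kindCount-mirror k left r) (kindCount-mirror k right l)) ⟩
  count k′ (replicate h younger) + (kindCount k′ right r + kindCount k′ left l)
    ≡⟨ cong (count k′ (replicate h younger) +_) (+-comm (kindCount k′ right r) (kindCount k′ left l)) ⟩
  count k′ (replicate h younger) + (kindCount k′ left l + kindCount k′ right r)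
    ∎
  where k′ = swapKind k

kindCount-right≡left : ∀ k d → 0 < size d → kindCount k right d ≡ kindCount k left d
kindCount-right≡left k (tip (suc g)) _ = refl
kindCount-right≡left k (bin h l r)   _ = refl

leafKinds-decode-tip : ∀ g → leafKinds (decode (tip g)) ≡ tipKinds left g
leafKinds-decode-tip zero    = refl
leafKinds-decode-tip (suc g) = begin
  (elderTwin ∷ second ∷ youngerKinds (leaves g ++ [])) ++ leafKindsL (leaves g ++ [])
    ≡⟨ cong₂ (λ ys zs → (elderTwin ∷ second ∷ ys) ++ zs)
             (trans (youngerKinds-leaves-++ g []) (++-identityʳ (replicate g younger)))
             (leafKindsL-leaves-++ g []) ⟩
  (elderTwin ∷ second ∷ replicate g younger) ++ []
    ≡⟨ ++-identityʳ _ ⟩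
  elderTwin ∷ second ∷ replicate g younger
    ∎

childKinds-interior : ∀ g l rest →
  childKinds (leaf ∷ leaves g ++ decode l ∷ rest) ≡ tipKinds right g ++ youngerKinds rest
childKinds-interior zero    l rest = refl
childKinds-interior (suc g) l rest =
  cong (λ ys → elderTwin ∷ second ∷ ys) (youngerKinds-leaves-++ g (decode l ∷ rest))

mutual
  numLeaves-decode : ∀ k d → numLeaves k (decode d) ≡ kindCount k left d
  numLeaves-decode k (tip g)       = cong (count k) (leafKinds-decode-tip g)
  numLeaves-decode k d@(bin h l r) = begin
    count k (childKinds (leaf ∷ children d) ++ leafKindsL (children d))
      ≡⟨ count-++ k (childKinds (leaf ∷ children d)) (leafKindsL (children d)) ⟩
    count k (childKinds (leaf ∷ children d)) + count k (leafKindsL (children d))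
      ≡⟨ cong₂ (λ xs ys → count k xs + count k ys)
               (childKinds-interior (lead r) l (leaves h ++ afterLead r))
               (leafKindsL-leaves-++ (lead r) (afterLead d)) ⟩
    count k (tipKinds right (lead d) ++ youngerKinds (afterLead d)) + count k (leafKindsL (afterLead d))
      ≡⟨ cong (_+ count k (leafKindsL (afterLead d))) (count-++ k (tipKinds right (lead d)) _) ⟩
    count k (tipKinds right (lead d)) + count k (youngerKinds (afterLead d)) + count k (leafKindsL (afterLead d))
      ≡⟨ count-afterLead k d ⟩
    kindCount k right d
      ∎

  count-afterLead : ∀ k d →
    count k (tipKinds right (lead d)) + count k (youngerKinds (afterLead d)) + count k (leafKindsL (afterLead d))
      ≡ kindCount k right d
  count-afterLead k (tip g)     = trans (+-identityʳ _) (+-identityʳ _)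
  count-afterLead k (bin h l r) = begin
    T + count k (youngerKinds (leaves h ++ afterLead r)) + count k (leafKinds (decode l) ++ leafKindsL (leaves h ++ afterLead r))
      ≡⟨ cong₂ (λ xs ys → T + count k xs + count k (leafKinds (decode l) ++ ys))
               (youngerKinds-leaves-++ h (afterLead r)) (leafKindsL-leaves-++ h (afterLead r)) ⟩
    T + count k (replicate h younger ++ youngerKinds (afterLead r)) + count k (leafKinds (decode l) ++ leafKindsL (afterLead r))
      ≡⟨ cong₂ (λ a b → T + a + b) (count-++ k (replicate h younger) _) (count-++ k (leafKinds (decode l)) _) ⟩
    T + (H + Y) + (numLeaves k (decode l) + L)
      ≡⟨ cong (λ c → T + (H + Y) + (c + L)) (numLeaves-decode k l) ⟩
    T + (H + Y) + (kindCount k left l + L)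
      ≡⟨ rearrange T H Y (kindCount k left l) L ⟩
    H + (kindCount k left l + (T + Y + L))
      ≡⟨ cong (λ c → H + (kindCount k left l + c)) (count-afterLead k r) ⟩
    H + (kindCount k left l + kindCount k right r)
      ∎
    where
    T = count k (tipKinds right (lead r))
    H = count k (replicate h younger)
    Y = count k (youngerKinds (afterLead r))
    L = count k (leafKindsL (afterLead r))
    rearrange : ∀ t h y c l → t + (h + y) + (c + l) ≡ h + (c + (t + y + l))
    rearrange = solve-∀

mirrorTree : PTree → PTree
mirrorTree (node [])       = node []
mirrorTree (node (_ ∷ cs)) = decode (mirror (encodeChildren cs))

tipAugmented-mirrorTree : ∀ t → tipAugmented (mirrorTree t) ≡ true
tipAugmented-mirrorTree (node [])       = refl
tipAugmented-mirrorTree (node (_ ∷ cs)) = tipAugmentedL-children (mirror (encodeChildren cs))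

mirrorTree-involutive : ∀ t → tipAugmented t ≡ true → mirrorTree (mirrorTree t) ≡ t
mirrorTree-involutive (node [])       _  = refl
mirrorTree-involutive (node (c ∷ cs)) ta = begin
  decode (mirror (encodeChildren (children (mirror d)))) ≡⟨ cong (decode ∘ mirror) (encodeChildren-children (mirror d)) ⟩
  decode (mirror (mirror d))                             ≡⟨ cong decode (mirror-involutive d) ⟩
  decode d                                               ≡⟨ decode-encodeChildren c cs ta ⟩
  node (c ∷ cs)                                          ∎
  where d = encodeChildren cs

edges-mirrorTree : ∀ t → tipAugmented t ≡ true → edges (mirrorTree t) ≡ edges t
edges-mirrorTree (node [])       _  = refl
edges-mirrorTree (node (c ∷ cs)) ta = begin
  edges (decode (mirror d)) ≡⟨ edges-decode (mirror d) ⟩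
  suc (size (mirror d))     ≡⟨ cong suc (size-mirror d) ⟩
  suc (size d)              ≡⟨ sym (edges-decode d) ⟩
  edges (decode d)          ≡⟨ cong edges (decode-encodeChildren c cs ta) ⟩
  edges (node (c ∷ cs))     ∎
  where d = encodeChildren cs

numLeaves-mirrorTree : ∀ k t → tipAugmented t ≡ true → 2 ≤ edges t →
  numLeaves k (mirrorTree t) ≡ numLeaves (swapKind k) t
numLeaves-mirrorTree k (node (c ∷ cs)) ta 2≤edges = begin
  numLeaves k (decode (mirror d))     ≡⟨ numLeaves-decode k (mirror d) ⟩
  kindCount k left (mirror d)         ≡⟨ kindCount-mirror k left d ⟩
  kindCount k′ right d                ≡⟨ kindCount-right≡left k′ d 0<size ⟩
  kindCount k′ left d                 ≡⟨ sym (numLeaves-decode k′ d) ⟩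
  numLeaves k′ (decode d)             ≡⟨ cong (numLeaves k′) decode-d ⟩
  numLeaves k′ (node (c ∷ cs))        ∎
  where
  d = encodeChildren cs
  k′ = swapKind k
  decode-d = decode-encodeChildren c cs ta
  0<size : 0 < size d
  0<size = ≤-pred (subst (2 ≤_) (trans (cong edges (sym decode-d)) (edges-decode d)) 2≤edges)

mirrorTAPT : ∀ {n i j k r s} → 2 ≤ n → TAPT n i j k r s → TAPT n k j i r s
mirrorTAPT 2≤n (t , ta , e , ei , ej , ek , er , es) =
  mirrorTree t , tipAugmented-mirrorTree t , trans (edges-mirrorTree t ta) e ,
  swapped singleton ek , swapped elderTwin ej , swapped elderNonTwin ei ,
  swapped younger er , swapped second es
  where
  swapped : ∀ kind {m} → numLeaves (swapKind kind) t ≡ m → numLeaves kind (mirrorTree t) ≡ m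
  swapped kind = trans (numLeaves-mirrorTree kind t ta (subst (2 ≤_) (sym e) 2≤n))

TAPT-≡ : ∀ {n i j k r s} {x y : TAPT n i j k r s} → proj₁ x ≡ proj₁ y → x ≡ y
TAPT-≡ {x = _ , ta , refl , refl , refl , refl , refl , refl}
       {y = _ , ta′ , refl , refl , refl , refl , refl , refl} refl =
  cong (λ p → _ , p , refl , refl , refl , refl , refl , refl) (uip ta ta′)

mirrorTAPT-involutive : ∀ {n i j k r s} (2≤n : 2 ≤ n) (x : TAPT n i j k r s) →
  mirrorTAPT 2≤n (mirrorTAPT 2≤n x) ≡ x
mirrorTAPT-involutive 2≤n x@(t , ta , _) = TAPT-≡ (mirrorTree-involutive t ta)

proposition1p18 : (n i j k r s : ℕ) → n ≥ 3 →
    TAPT n i j k r s ↔ TAPT n k j i r s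
proposition1p18 n i j k r s 3≤n =
  mk↔ₛ′ (mirrorTAPT 2≤n) (mirrorTAPT 2≤n) (mirrorTAPT-involutive 2≤n) (mirrorTAPT-involutive 2≤n)
  where
  2≤n : 2 ≤ n
  2≤n = <⇒≤ 3≤n
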